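{- Let $d\geq 2$ and let $f:\mathbb{N}_0\to\mathbb{N}_0$ be a function with $f(n)=\omega(n^{(d+1)/d})$. For every $n\geq0$ let $S_n=[-f(n),f(n)]^d$ and $\underline{S}=(S_n)_{n\ge0}$. Then for every sequence of activated vertices $\underline{v}$, the burning density $\delta(\underline{S},\underline{v})$ exists and equals $0$.
   Context: $\mathbb{N}_0$ is the set of nonnegative integers. For an integer $a\ge0$, $[-a,a]^d$ denotes the graph on vertex set $[-a,a]^d\subset\mathbb{Z}^d$ in which two vertices are adjacent iff their $L_1$-distance is $1$. Burning process: let $\underline{G}=(G_0,G_1,\dots)$ be graphs with $G_{n-1}$ an induced subgraph of $G_n$ for all $n\ge1$. A sequence of activated vertices is $\underline{v}=(v_n)_{n\ge0}$ with $v_n\in V(G_n)\cup\{\bullet\}$ ($\bullet$ means no vertex is activated). Burning sets: $B_0=\{v_0\}$ (empty if $v_0=\bullet$), and $B_{n+1}=N_{G_{n+1}}[B_n]$ if $v_{n+1}=\bullet$, and $B_{n+1}=N_{G_{n+1}}[B_n]\cup\{v_{n+1}\}$ otherwise, where $N_G[X]$ is the closed neighbourhood of $X$ in $G$. The burning density is $\delta(\underline{G},\underline{v})=\lim_{n\to\infty}|B_n|/|V(G_n)|$ when the limit exists. -}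

module Defs where

open import Data.Nat using (ℕ; zero; suc; _+_; _*_; _^_; _≤_)
open import Data.Integer as ℤ using (ℤ; +_; ∣_∣) renaming (_-_ to _⊖ᶻ_; _≤_ to _≤ᶻ_; -_ to -ᶻ_)
open import Data.Vec using (Vec; zipWith; sum)
open import Data.Vec.Relation.Unary.All using (All)
open import Data.Maybe using (Maybe; just)
open import Data.Product using (_×_; ∃)
open import Data.Sum using (_⊎_)
open import Relation.Binary.PropositionalEquality using (_≡_)

Point : ℕ → Set
Point d = Vec ℤ d

l1 : ∀ {d} → Point d → Point d → ℕ
l1 x y = sum (zipWith (λ a b → ∣ a ⊖ᶻ b ∣) x y)

Adjacent : ∀ {d} → Point d → Point d → Set
Adjacent x y = l1 x y ≡ 1

InBox : ∀ {d} → ℕ → Point d → Set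
InBox a x = All (λ z → (-ᶻ (+ a)) ≤ᶻ z × z ≤ᶻ (+ a)) x

boxSize : ℕ → ℕ → ℕ
boxSize d a = (2 * a + 1) ^ d

-- A sequence of activated vertices for the graph sequence ([-r n, r n]^d)_n :
-- nothing = • (no vertex activated), just x requires x ∈ V(G_n).
ValidActivation : ∀ {d} → (ℕ → ℕ) → (ℕ → Maybe (Point d)) → Set
ValidActivation {d} r v = ∀ n (x : Point d) → v n ≡ just x → InBox (r n) x

-- Burning sets B_n for G_n = [-r n, r n]^d, as predicates on ℤ^d.
-- B_0 = {v_0};  B_{n+1} = N_{G_{n+1}}[B_n] ∪ {v_{n+1}}.
Burning : ∀ {d} → (ℕ → ℕ) → (ℕ → Maybe (Point d)) → ℕ → Point d → Set
Burning r v zero x = v zero ≡ just x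
Burning {d} r v (suc n) x =
  (InBox (r (suc n)) x ×
    (Burning r v n x ⊎ ∃ λ (y : Point d) → Burning r v n y × Adjacent y x))
  ⊎ v (suc n) ≡ just x

module Submission where

-- A vertex can only burn at time n if fire reached it from a vertex v_i
-- activated at some time i ≤ n, and fire advances by one L1-step per round.
-- Since the L∞-distance never exceeds the L1-distance, every vertex of B_n
-- lies in the L∞-ball of radius n (a cube of side 2n+1) around some activated
-- v_i with i ≤ n.  Hence |B_n| ≤ (n+1)(2n+1)^d ≤ (3n)^(d+1), and because
-- f(n)^d eventually dominates K·n^(d+1) for K = k·3^(d+1), we get
-- k·|B_n| ≤ f(n)^d ≤ (2f(n)+1)^d = |V(S_n)|: the burning density is 0.

open import Defs
open import Data.Nat using (ℕ; suc; _+_; _*_; _^_; _≤_)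
open import Data.Vec using (Vec)
open import Data.Integer using (ℤ)
open import Data.Maybe using (Maybe)
open import Data.List using (List; length)
open import Data.List.Membership.Propositional using (_∈_)
open import Data.List.Relation.Unary.Unique.Propositional using (Unique)
open import Data.Product using (∃; _×_)
open import Function.Bundles using (_⇔_)

open import Data.Nat using (zero; z≤n; s≤s; _∸_; _≟_)
import Data.Nat.Properties as NP
open import Data.Nat.Tactic.RingSolver as ℕ-Solver using ()
import Data.Integer as Z
open Z using (∣_∣)
import Data.Integer.Properties as ZP
open import Data.Integer.Tactic.RingSolver as ℤ-Solver using ()
open import Data.Vec using ([]; _∷_)
open import Data.Maybe using (just; nothing)
open import Data.List using ([]; _∷_; _++_; map; applyUpTo; cartesianProductWith)
open import Data.List.Properties using (length-++; length-map; length-applyUpTo)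
open import Data.List.Relation.Unary.Any using (here; there)
open import Data.List.Relation.Unary.All as All using ()
open import Data.List.Relation.Unary.AllPairs using ([]; _∷_)
open import Data.List.Membership.Propositional.Properties
  using (∈-++⁺ˡ; ∈-++⁺ʳ; ∈-applyUpTo⁺; ∈-cartesianProductWith⁺)
open import Data.Product using (_,_)
open import Data.Unit using (⊤; tt)
open import Data.Empty using (⊥-elim)
open import Data.Sum using (inj₁; inj₂)
open import Relation.Binary.PropositionalEquality
open import Function.Bundles using (Equivalence)
open import Relation.Nullary using (yes; no)

-- Counting: a duplicate-free list whose members all occur in M is no longer
-- than M.  This turns the set inclusion B_n ⊆ (union of cubes) into a bound
-- on the length of any enumeration of B_n.

module _ {A : Set} where

  removeMember : ∀ {x : A} (M : List A) → x ∈ M → List A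
  removeMember (_ ∷ M) (here _)  = M
  removeMember (m ∷ M) (there p) = m ∷ removeMember M p

  length-removeMember : ∀ {x : A} (M : List A) (p : x ∈ M) →
                        suc (length (removeMember M p)) ≡ length M
  length-removeMember (_ ∷ M) (here _)  = refl
  length-removeMember (m ∷ M) (there p) = cong suc (length-removeMember M p)

  ∈-removeMember : ∀ {x y : A} {M : List A} → y ∈ M → x ≢ y → (p : x ∈ M) →
                   y ∈ removeMember M p
  ∈-removeMember (here y≡m)  x≢y (here x≡m) = ⊥-elim (x≢y (trans x≡m (sym y≡m)))
  ∈-removeMember (here y≡m)  x≢y (there p)  = here y≡m
  ∈-removeMember (there y∈M) x≢y (here _)   = y∈M
  ∈-removeMember (there y∈M) x≢y (there p)  = there (∈-removeMember y∈M x≢y p)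

  Unique-length-≤ : (L M : List A) → Unique L → (∀ {x} → x ∈ L → x ∈ M) →
                    length L ≤ length M
  Unique-length-≤ []      M []           L⊆M = z≤n
  Unique-length-≤ (x ∷ L) M (x∉L ∷ uniq) L⊆M =
    subst (suc (length L) ≤_) (length-removeMember M x∈M)
      (s≤s (Unique-length-≤ L (removeMember M x∈M) uniq
              (λ y∈L → ∈-removeMember (L⊆M (there y∈L)) (All.lookup x∉L y∈L) x∈M)))
    where x∈M = L⊆M (here refl)

WithinL∞ : ∀ {d} → ℕ → Point d → Point d → Set
WithinL∞ r []      []      = ⊤
WithinL∞ r (c ∷ cs) (a ∷ as) = ∣ a Z.- c ∣ ≤ r × WithinL∞ r cs as

withinL∞-refl : ∀ {d} (x : Point d) → WithinL∞ 0 x x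
withinL∞-refl []      = tt
withinL∞-refl (a ∷ x) = NP.≤-reflexive (cong ∣_∣ (ZP.+-inverseʳ a)) , withinL∞-refl x

withinL∞-mono : ∀ {d r s} → r ≤ s → (c x : Point d) → WithinL∞ r c x → WithinL∞ s c x
withinL∞-mono r≤s []       []       _         = tt
withinL∞-mono r≤s (c ∷ cs) (a ∷ as) (h , hs) = NP.≤-trans h r≤s , withinL∞-mono r≤s cs as hs

dist-triangle : ∀ a b c → ∣ b Z.- c ∣ ≤ ∣ a Z.- b ∣ + ∣ a Z.- c ∣
dist-triangle a b c = begin
  ∣ b Z.- c ∣                     ≡⟨ cong ∣_∣ (split a b c) ⟩
  ∣ (b Z.- a) Z.+ (a Z.- c) ∣     ≤⟨ ZP.∣i+j∣≤∣i∣+∣j∣ (b Z.- a) (a Z.- c) ⟩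
  ∣ b Z.- a ∣ + ∣ a Z.- c ∣       ≡⟨ cong (_+ ∣ a Z.- c ∣) (ZP.∣i-j∣≡∣j-i∣ b a) ⟩
  ∣ a Z.- b ∣ + ∣ a Z.- c ∣       ∎
  where
  open NP.≤-Reasoning
  split : ∀ a b c → b Z.- c ≡ (b Z.- a) Z.+ (a Z.- c)
  split = ℤ-Solver.solve-∀

-- The L∞-distance is at most the L1-distance: moving x to a point at
-- L1-distance ≤ s enlarges the L∞-radius around any centre by at most s.
withinL∞-step : ∀ {d} r s (c x x' : Point d) → WithinL∞ r c x → l1 x x' ≤ s →
                WithinL∞ (s + r) c x'
withinL∞-step r s []       []       []         _        _     = tt
withinL∞-step r s (c ∷ cs) (a ∷ as) (a' ∷ as') (h , hs) x~x' =
  NP.≤-trans (dist-triangle a a' c) (NP.+-mono-≤ (NP.m+n≤o⇒m≤o ∣ a Z.- a' ∣ x~x') h) ,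
  withinL∞-step r s cs as as' hs (NP.m+n≤o⇒n≤o ∣ a Z.- a' ∣ x~x')

window : ℤ → ℕ → List ℤ
window c R = applyUpTo (λ s → (c Z.- Z.+ R) Z.+ Z.+ s) (suc (R + R))

shift-into-range : ∀ e R → ∣ e ∣ ≤ R → ∃ λ s → s ≤ R + R × e Z.+ Z.+ R ≡ Z.+ s
shift-into-range (Z.+ p)      R p≤R   = p + R , NP.+-monoˡ-≤ R p≤R , refl
shift-into-range (Z.-[1+ p ]) R 1+p≤R =
  R ∸ suc p , NP.≤-trans (NP.m∸n≤m R (suc p)) (NP.m≤m+n R R) , ZP.⊖-≥ 1+p≤R

∈-window : ∀ R c b → ∣ b Z.- c ∣ ≤ R → b ∈ window c R
∈-window R c b near with shift-into-range (b Z.- c) R near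
... | s , s≤2R , b-c+R≡s =
  subst (_∈ window c R) b≡ (∈-applyUpTo⁺ (λ s → (c Z.- Z.+ R) Z.+ Z.+ s) (s≤s s≤2R))
  where
  recentre : ∀ b c r → (c Z.- r) Z.+ ((b Z.- c) Z.+ r) ≡ b
  recentre = ℤ-Solver.solve-∀
  b≡ : (c Z.- Z.+ R) Z.+ Z.+ s ≡ b
  b≡ = trans (cong (λ t → (c Z.- Z.+ R) Z.+ t) (sym b-c+R≡s)) (recentre b c (Z.+ R))

length-cartesianProductWith : ∀ {A B C : Set} (g : A → B → C) (xs : List A) (ys : List B) →
  length (cartesianProductWith g xs ys) ≡ length xs * length ys
length-cartesianProductWith g []       ys = refl
length-cartesianProductWith g (x ∷ xs) ys = begin
  length (map (g x) ys ++ cartesianProductWith g xs ys)          ≡⟨ length-++ (map (g x) ys) ⟩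
  length (map (g x) ys) + length (cartesianProductWith g xs ys)  ≡⟨ cong₂ _+_ (length-map (g x) ys)
                                                                      (length-cartesianProductWith g xs ys) ⟩
  length ys + length xs * length ys                              ∎
  where open ≡-Reasoning

cube : ∀ {d} → ℕ → Point d → List (Point d)
cube R []       = [] ∷ []
cube R (c ∷ cs) = cartesianProductWith _∷_ (window c R) (cube R cs)

length-cube : ∀ {d} R (c : Point d) → length (cube R c) ≡ suc (R + R) ^ d
length-cube R []       = refl
length-cube {suc d} R (c ∷ cs) = begin
  length (cube R (c ∷ cs))                       ≡⟨ length-cartesianProductWith _∷_ (window c R) (cube R cs) ⟩
  length (window c R) * length (cube R cs)       ≡⟨ cong₂ _*_ (length-applyUpTo (λ s → (c Z.- Z.+ R) Z.+ Z.+ s) (suc (R + R))) (length-cube R cs) ⟩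
  suc (R + R) * suc (R + R) ^ d                  ∎
  where open ≡-Reasoning

∈-cube : ∀ {d} R (c x : Point d) → WithinL∞ R c x → x ∈ cube R c
∈-cube R []       []       _        = here refl
∈-cube R (c ∷ cs) (a ∷ as) (h , hs) =
  ∈-cartesianProductWith⁺ _∷_ (∈-window R c a h) (∈-cube R cs as hs)

module Covering {d : ℕ} (f : ℕ → ℕ) (v : ℕ → Maybe (Point d)) where

  NearActivated : ℕ → Point d → Set
  NearActivated n x = ∃ λ i → ∃ λ c → i ≤ n × v i ≡ just c × WithinL∞ n c x

  -- The invariant of the burning process: B_n consists of vertices near
  -- vertices activated by time n (fire spreads one L1-step per round).
  burning⇒nearActivated : ∀ n x → Burning f v n x → NearActivated n x
  burning⇒nearActivated zero x v₀≡x = 0 , x , z≤n , v₀≡x , withinL∞-refl x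
  burning⇒nearActivated (suc n) x (inj₁ (_ , inj₁ x∈Bₙ))
    with burning⇒nearActivated n x x∈Bₙ
  ... | i , c , i≤n , vᵢ≡c , near =
    i , c , NP.m≤n⇒m≤1+n i≤n , vᵢ≡c , withinL∞-mono (NP.n≤1+n n) c x near
  burning⇒nearActivated (suc n) x (inj₁ (_ , inj₂ (y , y∈Bₙ , y~x)))
    with burning⇒nearActivated n y y∈Bₙ
  ... | i , c , i≤n , vᵢ≡c , near =
    i , c , NP.m≤n⇒m≤1+n i≤n , vᵢ≡c , withinL∞-step n 1 c y x near (NP.≤-reflexive y~x)
  burning⇒nearActivated (suc n) x (inj₂ vₙ₊₁≡x) =
    suc n , x , NP.≤-refl , vₙ₊₁≡x , withinL∞-mono z≤n x x (withinL∞-refl x)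

  cubeAround : ℕ → Maybe (Point d) → List (Point d)
  cubeAround R nothing  = []
  cubeAround R (just c) = cube R c

  activatedCubes : ℕ → ℕ → List (Point d)
  activatedCubes R zero    = cubeAround R (v 0)
  activatedCubes R (suc m) = cubeAround R (v (suc m)) ++ activatedCubes R m

  length-cubeAround : ∀ R o → length (cubeAround R o) ≤ suc (R + R) ^ d
  length-cubeAround R nothing  = z≤n
  length-cubeAround R (just c) = NP.≤-reflexive (length-cube R c)

  length-activatedCubes : ∀ R m → length (activatedCubes R m) ≤ suc m * suc (R + R) ^ d
  length-activatedCubes R zero =
    subst (length (cubeAround R (v 0)) ≤_) (sym (NP.+-identityʳ (suc (R + R) ^ d)))
      (length-cubeAround R (v 0))
  length-activatedCubes R (suc m) =
    subst (_≤ _) (sym (length-++ (cubeAround R (v (suc m)))))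
      (NP.+-mono-≤ (length-cubeAround R (v (suc m))) (length-activatedCubes R m))

  ∈-activatedCubes : ∀ R m i c x → i ≤ m → v i ≡ just c → WithinL∞ R c x →
                     x ∈ activatedCubes R m
  ∈-activatedCubes R zero    .zero c x z≤n vᵢ≡c near rewrite vᵢ≡c = ∈-cube R c x near
  ∈-activatedCubes R (suc m) i    c x i≤m vᵢ≡c near with i ≟ suc m
  ... | yes refl rewrite vᵢ≡c = ∈-++⁺ˡ (∈-cube R c x near)
  ... | no  i≢m =
    ∈-++⁺ʳ (cubeAround R (v (suc m)))
      (∈-activatedCubes R m i c x (NP.≤-pred (NP.≤∧≢⇒< i≤m i≢m)) vᵢ≡c near)

  burning-count : ∀ n (L : List (Point d)) → Unique L → (∀ x → (x ∈ L) ⇔ Burning f v n x) →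
                  length L ≤ suc n * suc (n + n) ^ d
  burning-count n L uniq L≡Bₙ =
    NP.≤-trans (Unique-length-≤ L (activatedCubes n n) uniq L⊆cubes) (length-activatedCubes n n)
    where
    L⊆cubes : ∀ {x} → x ∈ L → x ∈ activatedCubes n n
    L⊆cubes {x} x∈L with burning⇒nearActivated n x (Equivalence.to (L≡Bₙ x) x∈L)
    ... | i , c , i≤n , vᵢ≡c , near = ∈-activatedCubes n n i c x i≤n vᵢ≡c near

^-distribʳ-* : ∀ a b e → (a * b) ^ e ≡ a ^ e * b ^ e
^-distribʳ-* a b zero    = refl
^-distribʳ-* a b (suc e) = trans (cong ((a * b) *_) (^-distribʳ-* a b e)) (interchange a b _ _)
  where
  interchange : ∀ a b c e → a * b * (c * e) ≡ a * c * (b * e)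
  interchange = ℕ-Solver.solve-∀

cover-estimate : ∀ d n → 1 ≤ n → suc n * suc (n + n) ^ d ≤ 3 ^ (d + 1) * n ^ (d + 1)
cover-estimate d n 1≤n = begin
  suc n * suc (n + n) ^ d      ≤⟨ NP.*-mono-≤ n+1≤3n (NP.^-monoˡ-≤ d 2n+1≤3n) ⟩
  (3 * n) ^ suc d              ≡⟨ cong ((3 * n) ^_) (NP.+-comm 1 d) ⟩
  (3 * n) ^ (d + 1)            ≡⟨ ^-distribʳ-* 3 n (d + 1) ⟩
  3 ^ (d + 1) * n ^ (d + 1)    ∎
  where
  open NP.≤-Reasoning
  2n+1≤3n : suc (n + n) ≤ 3 * n
  2n+1≤3n = subst (suc (n + n) ≤_) (sym (cong (n +_) (cong (n +_) (NP.+-identityʳ n))))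
              (NP.+-monoˡ-≤ (n + n) 1≤n)
  n+1≤3n : suc n ≤ 3 * n
  n+1≤3n = NP.≤-trans (s≤s (NP.m≤m+n n n)) 2n+1≤3n

power≤boxSize : ∀ d a → a ^ d ≤ boxSize d a
power≤boxSize d a = NP.^-monoˡ-≤ d (NP.≤-trans (NP.m≤m+n a (a + 0)) (NP.m≤m+n _ 1))

theorem3 : (d : ℕ) → 2 ≤ d → (f : ℕ → ℕ)
    → (∀ m n → m ≤ n → f m ≤ f n)
    → (∀ K → ∃ λ N → ∀ n → N ≤ n → K * n ^ (d + 1) ≤ f n ^ d)
    → (v : ℕ → Maybe (Vec ℤ d)) → ValidActivation f v
    → ∀ k → ∃ λ N → ∀ n → N ≤ n
    → (L : List (Vec ℤ d)) → Unique L → (∀ x → (x ∈ L) ⇔ Burning f v n x)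
    → k * length L ≤ boxSize d (f n)
theorem3 d _ f _ superpolynomial v _ k with superpolynomial (k * 3 ^ (d + 1))
... | N , dominated = suc N , λ n N<n L uniq L≡Bₙ → begin
  k * length L                      ≤⟨ NP.*-monoʳ-≤ k (Covering.burning-count f v n L uniq L≡Bₙ) ⟩
  k * (suc n * suc (n + n) ^ d)     ≤⟨ NP.*-monoʳ-≤ k (cover-estimate d n (NP.≤-trans (s≤s z≤n) N<n)) ⟩
  k * (3 ^ (d + 1) * n ^ (d + 1))   ≡⟨ NP.*-assoc k (3 ^ (d + 1)) (n ^ (d + 1)) ⟨
  k * 3 ^ (d + 1) * n ^ (d + 1)     ≤⟨ dominated n (NP.≤-trans (NP.n≤1+n N) N<n) ⟩
  f n ^ d                           ≤⟨ power≤boxSize d (f n) ⟩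
  boxSize d (f n)                   ∎
  where open NP.≤-Reasoning
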